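{- Let $P$ be a poset on $\{1,\ldots,n\}$ and let $D_1,\ldots,D_\ell$ be the connected components of $H_P$. (1) Let $1\le r<s\le\ell$ and let $J_a,J_b$ be connected order ideals of $P$ such that $\chi_{J_a}$ is a subgraph of $D_r$ and $\chi_{J_b}$ is a subgraph of $D_s$. Then $J_a$ and $J_b$ are not adjacent in $G_P$. (2) Let $J$ be a connected order ideal such that $\chi_J$ is a subgraph of $D_r$ (so that $J\subseteq\bigcup_{\Lambda_i^P\in V(D_r)}\Lambda_i^P$). If $J\neq\bigcup_{\Lambda_i^P\in V(D_r)}\Lambda_i^P$, then there exists $\Lambda_j^P\in V(D_r)$ such that $J$ and $\Lambda_j^P$ are adjacent in $G_P$.
   Context: An order ideal of $P$ is a subset $J$ with $i\in J$, $j\le_P i\Rightarrow j\in J$; a nonempty order ideal is connected if the Hasse diagram of $P$ restricted to it is connected. Sets $A,B$ intersect nontrivially if $A\cap B\ne\emptyset$, $A\not\subseteq B$, $B\not\subseteq A$. $G_P$ is the simple graph whose vertices are the connected order ideals of $P$, adjacent iff they intersect nontrivially. $\Lambda_i^P=\{k:k\le_P i\}$. $H_P$ is the subgraph of $G_P$ induced by $\{\Lambda_1^P,\ldots,\Lambda_n^P\}$; $V(D)$ is the vertex set of a subgraph $D$. $gs(J)$ is the set of $\le_P$-maximal elements of $J$; if $gs(J)=\{i_1,\ldots,i_k\}$, $\chi_J$ is the subgraph of $G_P$ induced by $\{\Lambda_{i_1}^P,\ldots,\Lambda_{i_k}^P\}$. -}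

module Defs where

open import Level using (0ℓ)
open import Data.Nat using (ℕ)
open import Data.Fin using (Fin)
open import Data.Fin.Subset using (Subset; _∈_; _∉_; _⊆_; _∩_; Nonempty)
open import Data.Vec using (tabulate)
open import Data.Product using (_×_; ∃)
open import Data.Sum using (_⊎_)
open import Relation.Nullary using (¬_)
open import Relation.Nullary.Decidable using (⌊_⌋)
open import Relation.Binary using (Rel; IsDecPartialOrder)
open import Relation.Binary.PropositionalEquality using (_≡_)
open import Relation.Binary.Construct.Closure.ReflexiveTransitive using (Star)

NontrivInt : ∀ {n} → Subset n → Subset n → Set
NontrivInt A B = Nonempty (A ∩ B) × ¬ (A ⊆ B) × ¬ (B ⊆ A)

module Poset {n : ℕ} {_≼_ : Rel (Fin n) 0ℓ}
             (isPO : IsDecPartialOrder _≡_ _≼_) where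
  open IsDecPartialOrder isPO using (_≤?_)

  _≺_ : Rel (Fin n) 0ℓ
  x ≺ y = x ≼ y × ¬ (x ≡ y)

  _⋖_ : Rel (Fin n) 0ℓ
  x ⋖ y = x ≺ y × (∀ z → x ≼ z → z ≼ y → z ≡ x ⊎ z ≡ y)

  IsOrderIdeal : Subset n → Set
  IsOrderIdeal J = ∀ {i j} → i ∈ J → j ≼ i → j ∈ J

  data HassePath (J : Subset n) : Fin n → Fin n → Set where
    here  : ∀ {x} → x ∈ J → HassePath J x x
    up    : ∀ {x y z} → x ∈ J → x ⋖ y → HassePath J y z → HassePath J x z
    down  : ∀ {x y z} → x ∈ J → y ⋖ x → HassePath J y z → HassePath J x z

  IsConnIdeal : Subset n → Set
  IsConnIdeal J = IsOrderIdeal J × Nonempty J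
                  × (∀ {x y} → x ∈ J → y ∈ J → HassePath J x y)

  Λ : Fin n → Subset n
  Λ i = tabulate (λ k → ⌊ k ≤? i ⌋)

  -- adjacency in G_P (simple graph; nontrivial intersection forces distinctness)
  AdjG : Subset n → Subset n → Set
  AdjG = NontrivInt

  -- adjacency in H_P, indexed by the generators i of Λ_i
  AdjH : Rel (Fin n) 0ℓ
  AdjH i j = AdjG (Λ i) (Λ j)

  -- Λ_j lies in the connected component of H_P containing Λ_c
  InComp : Fin n → Fin n → Set
  InComp c j = Star AdjH c j

  IsMax : Subset n → Fin n → Set
  IsMax J i = i ∈ J × (∀ k → k ∈ J → i ≼ k → k ≡ i)

  -- χ_J is a subgraph of the component D of H_P containing Λ_c
  χ⊆Comp : Subset n → Fin n → Set
  χ⊆Comp J c = ∀ i → IsMax J i → InComp c i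

  InUnion : Fin n → Fin n → Set
  InUnion c x = ∃ λ i → InComp c i × x ≼ i

-- A connected order ideal J meets an order ideal Z nontrivially only if some generator Λ_m of J
-- (m maximal in J) already does: a Hasse path inside J from J ∩ Z to J ∖ Z crosses out of Z
-- along a cover u ⋖ v, and any maximal m ≥ v gives u ∈ Λ_m ∩ Z, v ∈ Λ_m ∖ Z, while Z ⊈ Λ_m ⊆ J.
-- Applying this twice, an edge Ja — Jb of G_P yields generators a of Ja and b of Jb with Λ_a — Λ_b
-- in H_P, so their components coincide. For (2), a point of the union outside J lies in some Λ_i of
-- the component; along a path in H_P from a generator of J (contained in J) to Λ_i, the first Λ_t
-- not contained in J meets J nontrivially.
module Submission where

open import Defs
open import Level using (0ℓ)
open import Data.Nat using (ℕ)
open import Data.Fin using (Fin)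
open import Data.Fin.Subset using (Subset; _∈_; _∉_; _⊆_; _∩_; _∪_; _⊃_; ⁅_⁆)
open import Data.Fin.Subset.Properties
  using (_∈?_; _⊆?_; nonempty?; x∈p∩q⁺; x∈p∩q⁻; x∈p∪q⁻; p⊆p∪q; q⊆p∪q; x∈⁅x⁆; x∈⁅y⁆⇒x≡y)
open import Data.Fin.Subset.Induction using (⊃-wellFounded)
open import Data.Fin.Properties using (any?)
open import Data.Fin.Induction using (spo-wellFounded)
open import Data.Product using (_×_; ∃; ∃₂; _,_; proj₁; proj₂; swap)
open import Data.Sum using (inj₁; inj₂)
open import Data.Empty using (⊥-elim)
open import Data.Bool.Properties using (T-≡)
open import Function.Base using (id; flip)
open import Function.Bundles using (_⇔_; mk⇔; Equivalence)
open import Induction.WellFounded using (Acc; acc; WellFounded)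
open import Relation.Nullary using (¬_; Dec; yes; no; contradiction)
open import Relation.Nullary.Decidable
  using (⌊_⌋; toWitness; fromWitness; map′; decidable-stable; _×-dec_; ¬?)
open import Relation.Unary as U using (Pred)
open import Relation.Binary using (Rel; Decidable; IsDecPartialOrder)
open import Relation.Binary.PropositionalEquality using (_≡_; sym; trans)
open import Relation.Binary.Construct.Closure.ReflexiveTransitive
  using (Star; ε; _◅_; _◅◅_; fold; reverse; return)
import Relation.Binary.Construct.NonStrictToStrict as NonStrictToStrict
import Relation.Binary.Construct.Flip.EqAndOrd as Flip
open import Data.Vec.Properties using (lookup∘tabulate; []=⇒lookup; lookup⇒[]=)

⊈-witness : ∀ {n} {P Q : Pred (Fin n) 0ℓ} → U.Decidable P → U.Decidable Q →
            ¬ (P U.⊆ Q) → ∃ λ x → P x × ¬ Q x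
⊈-witness P? Q? P⊈Q with any? (λ x → P? x ×-dec ¬? (Q? x))
... | yes counterexample = counterexample
... | no none = contradiction (λ {x} Px → decidable-stable (Q? x) (λ ¬Qx → none (x , Px , ¬Qx))) P⊈Q

module Reachability {n : ℕ} {_~_ : Rel (Fin n) 0ℓ} (_~?_ : Decidable _~_) where

  ClosedUnder~ : Subset n → Set
  ClosedUnder~ R = ∀ {i j} → i ∈ R → i ~ j → j ∈ R

  closed⇒Star-closed : ∀ {R} → ClosedUnder~ R → ∀ {i j} → Star _~_ i j → i ∈ R → j ∈ R
  closed⇒Star-closed {R} R-closed =
    fold (λ i j → i ∈ R → j ∈ R) (λ i~k k⇒j i∈R → k⇒j (R-closed i∈R i~k)) id

  -- Add one ~-successor at a time; the set grows strictly, so ⊃ is the termination measure.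
  reachable-closure : ∀ {c} R → Acc _⊃_ R → c ∈ R → (∀ {j} → j ∈ R → Star _~_ c j) →
                      ∃ λ S → c ∈ S × (∀ {j} → j ∈ S → Star _~_ c j) × ClosedUnder~ S
  reachable-closure R (acc larger) c∈R reachable
    with any? (λ i → any? (λ j → ((i ∈? R) ×-dec (i ~? j)) ×-dec ¬? (j ∈? R)))
  ... | no no-exit =
    R , c∈R , reachable ,
    λ {i} {j} i∈R i~j → decidable-stable (j ∈? R) (λ j∉R → no-exit (i , j , (i∈R , i~j) , j∉R))
  ... | yes (i , j , (i∈R , i~j) , j∉R) =
    reachable-closure (R ∪ ⁅ j ⁆) (larger R⊂R∪j) (p⊆p∪q ⁅ j ⁆ c∈R) reachable′
    where
    R⊂R∪j : (R ∪ ⁅ j ⁆) ⊃ R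
    R⊂R∪j = p⊆p∪q ⁅ j ⁆ , j , q⊆p∪q R ⁅ j ⁆ (x∈⁅x⁆ j) , j∉R

    reachable′ : ∀ {k} → k ∈ R ∪ ⁅ j ⁆ → Star _~_ _ k
    reachable′ k∈R∪j with x∈p∪q⁻ R ⁅ j ⁆ k∈R∪j
    ... | inj₁ k∈R = reachable k∈R
    ... | inj₂ k∈j rewrite x∈⁅y⁆⇒x≡y j k∈j = reachable i∈R ◅◅ return i~j

  Star? : Decidable (Star _~_)
  Star? c j with reachable-closure ⁅ c ⁆ (⊃-wellFounded _) (x∈⁅x⁆ c) c-reaches-itself
    where
    c-reaches-itself : ∀ {k} → k ∈ ⁅ c ⁆ → Star _~_ c k
    c-reaches-itself k∈c rewrite x∈⁅y⁆⇒x≡y c k∈c = ε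
  ... | S , c∈S , reachable , S-closed =
    map′ reachable (λ c→j → closed⇒Star-closed S-closed c→j c∈S) (j ∈? S)

module _ {n : ℕ} {_≼_ : Rel (Fin n) 0ℓ} (isPO : IsDecPartialOrder _≡_ _≼_) where
  open Poset isPO
  open IsDecPartialOrder isPO
    using (_≤?_; isPartialOrder) renaming (refl to ≼-refl; trans to ≼-trans; _≟_ to _≟F_)

  ∈Λ⁻ : ∀ {x i} → x ∈ Λ i → x ≼ i
  ∈Λ⁻ {x} {i} x∈Λi = toWitness (Equivalence.from T-≡
    (trans (sym (lookup∘tabulate (λ k → ⌊ k ≤? i ⌋) x)) ([]=⇒lookup x∈Λi)))

  ∈Λ⁺ : ∀ {x i} → x ≼ i → x ∈ Λ i
  ∈Λ⁺ {x} {i} x≼i = lookup⇒[]= x (Λ i)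
    (trans (lookup∘tabulate (λ k → ⌊ k ≤? i ⌋) x) (Equivalence.to T-≡ (fromWitness x≼i)))

  Λ-isOrderIdeal : ∀ i → IsOrderIdeal (Λ i)
  Λ-isOrderIdeal i x∈Λi y≼x = ∈Λ⁺ (≼-trans y≼x (∈Λ⁻ x∈Λi))

  Λ⊆ideal : ∀ {J i} → IsOrderIdeal J → i ∈ J → Λ i ⊆ J
  Λ⊆ideal J-ideal i∈J x∈Λi = J-ideal i∈J (∈Λ⁻ x∈Λi)

  AdjG? : (A B : Subset n) → Dec (AdjG A B)
  AdjG? A B = nonempty? (A ∩ B) ×-dec ¬? (A ⊆? B) ×-dec ¬? (B ⊆? A)

  AdjG-sym : ∀ {A B} → AdjG A B → AdjG B A
  AdjG-sym {A} {B} ((x , x∈A∩B) , A⊈B , B⊈A) = (x , x∈p∩q⁺ (swap (x∈p∩q⁻ A B x∈A∩B))) , B⊈A , A⊈B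

  InComp-sym : ∀ {c d} → InComp c d → InComp d c
  InComp-sym = reverse AdjG-sym

  -- Extracting a point of the union outside J from J ≠ union needs membership in the union,
  -- hence connectivity in H_P, to be decidable.
  open Reachability {_~_ = AdjH} (λ i j → AdjG? (Λ i) (Λ j)) using () renaming (Star? to InComp?)

  InUnion? : ∀ c x → Dec (InUnion c x)
  InUnion? c x = any? (λ i → InComp? c i ×-dec (x ≤? i))

  ≺⁻¹-wellFounded : WellFounded (flip _≺_)
  ≺⁻¹-wellFounded = spo-wellFounded
    (Flip.isStrictPartialOrder (NonStrictToStrict.<-isStrictPartialOrder _≡_ _≼_ isPartialOrder))

  maximal-above : ∀ J {x} → x ∈ J → ∃ λ m → IsMax J m × x ≼ m
  maximal-above J {x} x∈J = go x (≺⁻¹-wellFounded x) x∈J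
    where
    go : ∀ x → Acc (flip _≺_) x → x ∈ J → ∃ λ m → IsMax J m × x ≼ m
    go x (acc above) x∈J with any? (λ k → (k ∈? J) ×-dec ((x ≤? k) ×-dec ¬? (x ≟F k)))
    ... | yes (k , k∈J , x≺k) with go k (above x≺k) k∈J
    ...   | m , m-max , k≼m = m , m-max , ≼-trans (proj₁ x≺k) k≼m
    go x _ x∈J | no nothing-above = x , (x∈J , x-max) , ≼-refl
      where
      x-max : ∀ k → k ∈ J → x ≼ k → k ≡ x
      x-max k k∈J x≼k with k ≟F x
      ... | yes k≡x = k≡x
      ... | no k≢x = contradiction (k , k∈J , x≼k , λ x≡k → k≢x (sym x≡k)) nothing-above

  HassePath-head : ∀ {J x y} → HassePath J x y → x ∈ J
  HassePath-head (here x∈J) = x∈J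
  HassePath-head (up x∈J _ _) = x∈J
  HassePath-head (down x∈J _ _) = x∈J

  -- Down-steps cannot leave the order ideal Z, so the path leaves Z along an up-step.
  HassePath-leaves-ideal : ∀ {J Z} → IsOrderIdeal Z → ∀ {x y} → HassePath J x y → x ∈ Z → y ∉ Z →
                           ∃₂ λ u v → u ∈ Z × v ∉ Z × u ≼ v × v ∈ J
  HassePath-leaves-ideal Z-ideal (here _) x∈Z x∉Z = contradiction x∈Z x∉Z
  HassePath-leaves-ideal {Z = Z} Z-ideal (up {y = y} _ x⋖y path) x∈Z z∉Z with y ∈? Z
  ... | yes y∈Z = HassePath-leaves-ideal Z-ideal path y∈Z z∉Z
  ... | no y∉Z = _ , y , x∈Z , y∉Z , proj₁ (proj₁ x⋖y) , HassePath-head path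
  HassePath-leaves-ideal Z-ideal (down _ y⋖x path) x∈Z z∉Z =
    HassePath-leaves-ideal Z-ideal path (Z-ideal x∈Z (proj₁ (proj₁ y⋖x))) z∉Z

  ⊈-witnessₛ : ∀ {A B : Subset n} → ¬ (A ⊆ B) → ∃ λ x → x ∈ A × x ∉ B
  ⊈-witnessₛ {A} {B} = ⊈-witness (_∈? A) (_∈? B)

  adjacent⇒maximal-adjacent : ∀ {J Z} → IsConnIdeal J → IsOrderIdeal Z → AdjG J Z →
                              ∃ λ m → IsMax J m × AdjG (Λ m) Z
  adjacent⇒maximal-adjacent {J} {Z} (J-ideal , _ , J-connected) Z-ideal ((r , r∈J∩Z) , J⊈Z , Z⊈J)
    with x∈p∩q⁻ J Z r∈J∩Z | ⊈-witnessₛ J⊈Z | ⊈-witnessₛ Z⊈J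
  ... | r∈J , r∈Z | p , p∈J , p∉Z | q , q∈Z , q∉J
    with HassePath-leaves-ideal Z-ideal (J-connected r∈J p∈J) r∈Z p∉Z
  ... | u , v , u∈Z , v∉Z , u≼v , v∈J with maximal-above J v∈J
  ... | m , m-max@(m∈J , _) , v≼m =
    m , m-max ,
    (u , x∈p∩q⁺ (∈Λ⁺ (≼-trans u≼v v≼m) , u∈Z)) ,
    (λ Λm⊆Z → v∉Z (Λm⊆Z (∈Λ⁺ v≼m))) ,
    (λ Z⊆Λm → q∉J (Λ⊆ideal J-ideal m∈J (Z⊆Λm q∈Z)))

  -- The first Λ_t on the path not contained in J cannot contain J, since its predecessor lies in J.
  Star-leaves-Λ⊆ : ∀ J {s i} → Star AdjH s i → Λ s ⊆ J → ¬ (Λ i ⊆ J) →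
                   ∃ λ t → InComp s t × AdjG J (Λ t)
  Star-leaves-Λ⊆ J ε Λs⊆J Λi⊈J = ⊥-elim (Λi⊈J Λs⊆J)
  Star-leaves-Λ⊆ J (_◅_ {j = t} s~t path) Λs⊆J Λi⊈J with Λ t ⊆? J
  ... | yes Λt⊆J with Star-leaves-Λ⊆ J path Λt⊆J Λi⊈J
  ...   | u , t→u , adj = u , s~t ◅ t→u , adj
  Star-leaves-Λ⊆ J (s~t ◅ path) Λs⊆J Λi⊈J | no Λt⊈J with J ⊆? Λ _
  ... | yes J⊆Λt = ⊥-elim (proj₁ (proj₂ s~t) (λ x∈Λs → J⊆Λt (Λs⊆J x∈Λs)))
  ... | no J⊈Λt with s~t
  ...   | (z , z∈Λs∩Λt) , _ with x∈p∩q⁻ _ _ z∈Λs∩Λt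
  ...     | z∈Λs , z∈Λt = _ , return s~t , (z , x∈p∩q⁺ (Λs⊆J z∈Λs , z∈Λt)) , J⊈Λt , Λt⊈J

  components-nonadjacent : ∀ c d → ¬ InComp c d → ∀ Ja Jb → IsConnIdeal Ja → IsConnIdeal Jb →
                           χ⊆Comp Ja c → χ⊆Comp Jb d → ¬ AdjG Ja Jb
  components-nonadjacent c d c≁d Ja Jb Ja-conn Jb-conn χa χb Ja~Jb
    with adjacent⇒maximal-adjacent Ja-conn (proj₁ Jb-conn) Ja~Jb
  ... | a , a-max , Λa~Jb
    with adjacent⇒maximal-adjacent Jb-conn (Λ-isOrderIdeal a) (AdjG-sym Λa~Jb)
  ... | b , b-max , Λb~Λa =
    c≁d (χa a a-max ◅◅ return (AdjG-sym Λb~Λa) ◅◅ InComp-sym (χb b b-max))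

  proper-adjacent-to-component : ∀ c J → IsConnIdeal J → χ⊆Comp J c →
                                 ¬ (∀ x → (x ∈ J) ⇔ InUnion c x) →
                                 ∃ λ j → InComp c j × AdjG J (Λ j)
  proper-adjacent-to-component c J (J-ideal , (x , x∈J) , _) χ J≢union
    with ⊈-witness (InUnion? c) (_∈? J) (λ y∈union → J≢union (λ y → mk⇔ (J⊆union y) y∈union))
    where
    J⊆union : ∀ y → y ∈ J → InUnion c y
    J⊆union y y∈J with maximal-above J y∈J
    ... | m , m-max , y≼m = m , χ m m-max , y≼m
  ... | y , (i , c→i , y≼i) , y∉J with maximal-above J x∈J
  ... | m , m-max@(m∈J , _) , _ with Star-leaves-Λ⊆ J (InComp-sym (χ m m-max) ◅◅ c→i)
                                       (Λ⊆ideal J-ideal m∈J) (λ Λi⊆J → y∉J (Λi⊆J (∈Λ⁺ y≼i)))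
  ... | t , m→t , J~Λt = t , χ m m-max ◅◅ m→t , J~Λt

lemma3p3 : (n : ℕ) (_≼_ : Rel (Fin n) 0ℓ) (isPO : IsDecPartialOrder _≡_ _≼_) →
    let open Poset isPO in
    (∀ (c d : Fin n) → ¬ InComp c d →
    ∀ (Ja Jb : Subset n) → IsConnIdeal Ja → IsConnIdeal Jb →
    χ⊆Comp Ja c → χ⊆Comp Jb d → ¬ AdjG Ja Jb)
    ×
    (∀ (c : Fin n) (J : Subset n) → IsConnIdeal J → χ⊆Comp J c →
    ¬ (∀ x → (x ∈ J) ⇔ InUnion c x) →
    ∃ λ j → InComp c j × AdjG J (Λ j))
lemma3p3 n _≼_ isPO = components-nonadjacent isPO , proper-adjacent-to-component isPO
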